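{- Let $w\ge2$ be an integer and let $D=(P_1,\dots,P_{w+1})\in\mathfrak D'_{w+1}$ with the $P_i$ pairwise distinct, $|P_1|=|P_2|=0$, and $|P_i|=i-2$ for $3\le i\le w+1$. Then the leading term of $\varphi(D)$ is $(|P_1|_y-|P_2|_y)\rho_w$; in particular $\mathrm{LM}(\varphi(D))=\rho_w$.
   Context: For a point $P=(a,b)$, $|P|=a+b$, $|P|_y=b$. $\mathfrak D'_m$ is the set of $m$-tuples $(P_1,\dots,P_m)$ of points $(a_i,b_i)$ with $a_i\in\mathbb Z$, $b_i\in\mathbb N$, $a_i+b_i\ge0$, listed in increasing order, where $(a,b)<(a',b')$ iff $a+b<a'+b'$, or $a+b=a'+b'$ and $a<a'$. $\rho_i$ has weight $i$, $\rho_0=1$; $h(b,w)$ is the weight-$w$ part of $(1+\rho_1+\rho_2+\cdots)^b$ ($0$ if $w<0$; $(\cdots)^0=1$). $\varphi(D)=(-1)^k\det[h(b_i,j-1-|P_i|)]_{1\le i,j\le m}$ with $k=\binom m2-\sum|P_i|$; it is a polynomial in the $\rho_i$ homogeneous of weight $k$. Monomials of equal weight are ordered by $\rho_\nu<\rho_\mu$ (indices written as nondecreasing sequences) if for some $j$, $\nu_i=\mu_i$ for $i<j$ and $\nu_j<\mu_j$; the leading term of a nonzero $f=\sum a_\nu\rho_\nu$ is $a_\nu\rho_\nu$ for the largest $\rho_\nu$ with $a_\nu\ne0$, and $\mathrm{LM}(f)$ is that monomial. -}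

module Defs where

open import Data.Nat as ℕ using (ℕ; zero; suc)
open import Data.Integer as ℤ using (ℤ; +_; -[1+_]; 0ℤ; 1ℤ)
open import Data.Fin as Fin using (Fin; toℕ; punchIn)
open import Data.List using (List; []; _∷_; _++_; map; concatMap; foldr)
import Data.List.Properties as LP
open import Data.Product using (_×_; _,_; proj₁; proj₂)
open import Data.Sum using (_⊎_)
open import Data.Bool using (Bool; true; false; if_then_else_)
open import Relation.Nullary using (¬_; does)
open import Relation.Binary.PropositionalEquality using (_≡_; _≢_)

-- Polynomials in the variables ρ₁, ρ₂, … with integer coefficients.
-- A monomial ρ_ν is represented by its index sequence ν, written as a
-- nondecreasing list of positive naturals (ρ₀ = 1 is not a variable).
-- A polynomial is a formal finite sum of terms (coefficient, monomial);
-- its actual coefficients are given by `coeff`.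

Monomial : Set
Monomial = List ℕ

Poly : Set
Poly = List (ℤ × Monomial)

insert : ℕ → Monomial → Monomial
insert x [] = x ∷ []
insert x (y ∷ ys) = if does (x ℕ.≤? y) then x ∷ y ∷ ys else y ∷ insert x ys

monMul : Monomial → Monomial → Monomial
monMul ν μ = foldr insert μ ν

0P : Poly
0P = []

1P : Poly
1P = (1ℤ , []) ∷ []

_+P_ : Poly → Poly → Poly
f +P g = f ++ g

-P_ : Poly → Poly
-P f = map (λ t → (ℤ.- proj₁ t , proj₂ t)) f

_*P_ : Poly → Poly → Poly
f *P g = concatMap (λ s → map (λ t → (proj₁ s ℤ.* proj₁ t , monMul (proj₂ s) (proj₂ t))) g) f

ρ : ℕ → Poly
ρ zero = 1P
ρ (suc c) = (1ℤ , suc c ∷ []) ∷ []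

coeff : Poly → Monomial → ℤ
coeff [] μ = 0ℤ
coeff ((c , ν) ∷ f) μ = if does (LP.≡-dec ℕ._≟_ ν μ) then c ℤ.+ coeff f μ else coeff f μ

-- h(b,w): weight-w part of (1 + ρ₁ + ρ₂ + ⋯)^b, for w ∈ ℕ:
-- (1+ρ₁+⋯)^0 = 1, and the weight-w part of (1+ρ₁+⋯)^(b+1)
-- is Σ_{c=0}^{w} ρ_c · (weight-(w-c) part of (1+ρ₁+⋯)^b).

sumUpTo : ℕ → (ℕ → Poly) → Poly
sumUpTo zero F = F 0
sumUpTo (suc n) F = sumUpTo n F +P F (suc n)

hℕ : ℕ → ℕ → Poly
hℕ zero zero = 1P
hℕ zero (suc w) = 0P
hℕ (suc b) w = sumUpTo w (λ c → ρ c *P hℕ b (w ℕ.∸ c))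

h : ℕ → ℤ → Poly
h b (+ w) = hℕ b w
h b -[1+ _ ] = 0P

sumFin : (n : ℕ) → (Fin n → Poly) → Poly
sumFin zero F = 0P
sumFin (suc n) F = F Fin.zero +P sumFin n (λ j → F (Fin.suc j))

signP : ℕ → Poly → Poly
signP zero f = f
signP (suc zero) f = -P f
signP (suc (suc k)) f = signP k f

det : (n : ℕ) → (Fin n → Fin n → Poly) → Poly
det zero M = 1P
det (suc n) M =
  sumFin (suc n) (λ j → signP (toℕ j)
    (M Fin.zero j *P det n (λ r s → M (Fin.suc r) (punchIn j s))))

Point : Set
Point = ℤ × ℕ

∣_∣ : Point → ℤ
∣ (a , b) ∣ = a ℤ.+ + b

∣_∣y : Point → ℕ
∣ (a , b) ∣y = b

_<pt_ : Point → Point → Set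
P <pt Q = (∣ P ∣ ℤ.< ∣ Q ∣) ⊎ ((∣ P ∣ ≡ ∣ Q ∣) × (proj₁ P ℤ.< proj₁ Q))

_≤pt_ : Point → Point → Set
P ≤pt Q = (P <pt Q) ⊎ (P ≡ Q)

-- membership in 𝔇'_m : points with a+b ≥ 0 listed in increasing order
-- (tuples indexed 0-based by Fin m)
InD' : (m : ℕ) → (Fin m → Point) → Set
InD' m P = (∀ i → 0ℤ ℤ.≤ ∣ P i ∣) × (∀ i j → i Fin.< j → P i ≤pt P j)

sumℤ : (m : ℕ) → (Fin m → ℤ) → ℤ
sumℤ zero F = 0ℤ
sumℤ (suc m) F = F Fin.zero ℤ.+ sumℤ m (λ j → F (Fin.suc j))

choose2 : ℕ → ℕ
choose2 m = (m ℕ.* (m ℕ.∸ 1)) ℕ./ 2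

weightD : (m : ℕ) → (Fin m → Point) → ℤ
weightD m P = + choose2 m ℤ.- sumℤ m (λ i → ∣ P i ∣)

-- φ(D) = (-1)^k det[ h(b_i, j-1-|P_i|) ] ; with 0-based column index j
-- the entry is h(b_i, j - |P_i|).
φ : (m : ℕ) → (Fin m → Point) → Poly
φ m P = signP ℤ.∣ weightD m P ∣
  (det m (λ i j → h (∣ P i ∣y) (+ toℕ j ℤ.- ∣ P i ∣)))

data _<Lex_ : Monomial → Monomial → Set where
  here  : ∀ {a b ν μ} → a ℕ.< b → (a ∷ ν) <Lex (b ∷ μ)
  there : ∀ {a ν μ} → ν <Lex μ → (a ∷ ν) <Lex (a ∷ μ)

LeadingTerm : Poly → ℤ → Monomial → Set
LeadingTerm f c μ =
  (c ≢ 0ℤ) × (coeff f μ ≡ c) × (∀ ν → coeff f ν ≢ 0ℤ → (ν ≡ μ) ⊎ (ν <Lex μ))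

-- Every entry h(b_i, j-1-|P_i|) is homogeneous of weight j-1-|P_i|, so φ(D) is homogeneous of
-- weight k = w, and every monomial of weight w other than ρ_w has smallest index below w.  It
-- remains to show that ρ_w has coefficient |P₁|_y - |P₂|_y, which is nonzero because distinct
-- points with |P₁| = |P₂| = 0 have different y-coordinates.  That coefficient is read off through
-- the ring map to ℤ[ε]/(ε²) sending ρ_w to ε and every other ρ_c to 0: it sends h(b, n) to 1 for
-- n = 0, to b ε for n = w and to 0 otherwise, so rows 1 and 2 of the matrix become
-- e₁ + b_i ε e_{w+1} and row i ≥ 3 becomes e_{i-1}, giving determinant (-1)^w (b₁ - b₂) ε.

module Submission where

open import Defs
open import Data.Nat using (ℕ; suc; _≤_; _∸_)
open import Data.Integer using (+_; _-_; 0ℤ)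
open import Data.Fin using (Fin; toℕ)
open import Data.List using (_∷_; [])
open import Data.Product using (_×_; proj₁)
open import Relation.Binary.PropositionalEquality using (_≡_; _≢_)

open import Data.Bool using (true; false; if_then_else_)
open import Data.Bool.Properties using (if-eta)
open import Data.Empty using (⊥-elim)
open import Data.Fin using (zero; suc; punchIn; fromℕ)
import Data.Fin.Properties as Finₚ
open import Data.Integer as ℤ using (ℤ; -[1+_]; 1ℤ)
import Data.Integer.Properties as ℤₚ
open import Data.Integer.Tactic.RingSolver using (solve; solve-∀)
open import Data.List using (_++_; map; length)
import Data.List.Properties as Listₚ
open import Data.List.Relation.Binary.Permutation.Propositional
  using (_↭_; ↭-refl; ↭-sym; ↭-trans; prep; swap)
open import Data.List.Relation.Binary.Permutation.Propositional.Properties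
  using (↭-length; All-resp-↭)
open import Data.List.Relation.Unary.All as All using (All)
import Data.List.Relation.Unary.All.Properties as Allₚ
open import Data.Nat as ℕ using (zero; _<_; z≤n; s≤s)
open import Data.Nat.DivMod using (_/_; +-distrib-/-∣ʳ; m*n/n≡m)
open import Data.Nat.Divisibility using (divides-refl)
open import Data.Nat.ListAction using (sum)
open import Data.Nat.ListAction.Properties using (sum-++; sum-↭)
import Data.Nat.Properties as ℕₚ
import Data.Nat.Tactic.RingSolver as ℕSolver
open import Data.Product using (_,_; proj₂)
open import Data.Sum using (_⊎_; inj₁; inj₂)
open import Function using (_∘_; id)
open import Relation.Binary.Definitions using (tri<; tri≈; tri>)
open import Relation.Binary.PropositionalEquality
  using (refl; sym; trans; cong; cong₂; subst; module ≡-Reasoning)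
open import Relation.Nullary using (does; yes; no)
open import Relation.Nullary.Decidable using (dec-true; dec-false)

data Dual : Set where
  dual : ℤ → ℤ → Dual

ε-part : Dual → ℤ
ε-part (dual _ b) = b

infixl 6 _+ᴰ_
infixl 7 _*ᴰ_ _·ᴰ_
infix  8 -ᴰ_

_+ᴰ_ _*ᴰ_ : Dual → Dual → Dual
dual a b +ᴰ dual c d = dual (a ℤ.+ c) (b ℤ.+ d)
dual a b *ᴰ dual c d = dual (a ℤ.* c) (a ℤ.* d ℤ.+ b ℤ.* c)

-ᴰ_ : Dual → Dual
-ᴰ dual a b = dual (ℤ.- a) (ℤ.- b)

_·ᴰ_ : ℤ → Dual → Dual
k ·ᴰ dual a b = dual (k ℤ.* a) (k ℤ.* b)

0ᴰ 1ᴰ ε : Dual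
0ᴰ = dual 0ℤ 0ℤ
1ᴰ = dual 1ℤ 0ℤ
ε  = dual 0ℤ 1ℤ

ε-part-+ᴰ : ∀ x y → ε-part (x +ᴰ y) ≡ ε-part x ℤ.+ ε-part y
ε-part-+ᴰ (dual _ _) (dual _ _) = refl

ε-part-·ᴰ : ∀ k x → ε-part (k ·ᴰ x) ≡ k ℤ.* ε-part x
ε-part-·ᴰ k (dual _ _) = refl

+ᴰ-assoc : ∀ x y z → x +ᴰ y +ᴰ z ≡ x +ᴰ (y +ᴰ z)
+ᴰ-assoc (dual a b) (dual c d) (dual e f) =
  cong₂ dual (solve (a ∷ c ∷ e ∷ [])) (solve (b ∷ d ∷ f ∷ []))

+ᴰ-identityˡ : ∀ x → 0ᴰ +ᴰ x ≡ x
+ᴰ-identityˡ (dual a b) = cong₂ dual (ℤₚ.+-identityˡ a) (ℤₚ.+-identityˡ b)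

+ᴰ-identityʳ : ∀ x → x +ᴰ 0ᴰ ≡ x
+ᴰ-identityʳ (dual a b) = cong₂ dual (ℤₚ.+-identityʳ a) (ℤₚ.+-identityʳ b)

*ᴰ-identityˡ : ∀ x → 1ᴰ *ᴰ x ≡ x
*ᴰ-identityˡ (dual a b) = cong₂ dual (solve (a ∷ [])) (solve (a ∷ b ∷ []))

*ᴰ-identityʳ : ∀ x → x *ᴰ 1ᴰ ≡ x
*ᴰ-identityʳ (dual a b) = cong₂ dual (solve (a ∷ [])) (solve (a ∷ b ∷ []))

*ᴰ-zeroˡ : ∀ x → 0ᴰ *ᴰ x ≡ 0ᴰ
*ᴰ-zeroˡ (dual a b) = cong₂ dual (solve (a ∷ [])) (solve (a ∷ b ∷ []))

*ᴰ-zeroʳ : ∀ x → x *ᴰ 0ᴰ ≡ 0ᴰ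
*ᴰ-zeroʳ (dual a b) = cong₂ dual (solve (a ∷ [])) (solve (a ∷ b ∷ []))

*ᴰ-distribˡ-+ᴰ : ∀ x y z → x *ᴰ (y +ᴰ z) ≡ x *ᴰ y +ᴰ x *ᴰ z
*ᴰ-distribˡ-+ᴰ (dual a b) (dual c d) (dual e f) =
  cong₂ dual (solve (a ∷ c ∷ e ∷ [])) (solve (a ∷ b ∷ c ∷ d ∷ e ∷ f ∷ []))

*ᴰ-distribʳ-+ᴰ : ∀ x y z → (y +ᴰ z) *ᴰ x ≡ y *ᴰ x +ᴰ z *ᴰ x
*ᴰ-distribʳ-+ᴰ (dual a b) (dual c d) (dual e f) =
  cong₂ dual (solve (a ∷ c ∷ e ∷ [])) (solve (a ∷ b ∷ c ∷ d ∷ e ∷ f ∷ []))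

-ᴰ-distrib-+ᴰ : ∀ x y → -ᴰ (x +ᴰ y) ≡ -ᴰ x +ᴰ -ᴰ y
-ᴰ-distrib-+ᴰ (dual a b) (dual c d) = cong₂ dual (ℤₚ.neg-distrib-+ a c) (ℤₚ.neg-distrib-+ b d)

-ᴰ-involutive : ∀ x → -ᴰ -ᴰ x ≡ x
-ᴰ-involutive (dual a b) = cong₂ dual (ℤₚ.neg-involutive a) (ℤₚ.neg-involutive b)

-ᴰ-·ᴰ : ∀ k x → (ℤ.- k) ·ᴰ x ≡ -ᴰ (k ·ᴰ x)
-ᴰ-·ᴰ k (dual a b) = cong₂ dual (solve (k ∷ a ∷ [])) (solve (k ∷ b ∷ []))

·ᴰ-identity : ∀ x → 1ℤ ·ᴰ x ≡ x
·ᴰ-identity (dual a b) = cong₂ dual (ℤₚ.*-identityˡ a) (ℤₚ.*-identityˡ b)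

*-·ᴰ-*ᴰ : ∀ k l x y → (k ℤ.* l) ·ᴰ (x *ᴰ y) ≡ (k ·ᴰ x) *ᴰ (l ·ᴰ y)
*-·ᴰ-*ᴰ k l (dual a b) (dual c d) =
  cong₂ dual (solve (k ∷ l ∷ a ∷ c ∷ [])) (solve (k ∷ l ∷ a ∷ b ∷ c ∷ d ∷ []))

pure-ε-nilpotent : ∀ b d → dual 0ℤ b *ᴰ dual 0ℤ d ≡ 0ᴰ
pure-ε-nilpotent b d = cong₂ dual refl (solve (b ∷ d ∷ []))

sumFinᴰ : (n : ℕ) → (Fin n → Dual) → Dual
sumFinᴰ zero    F = 0ᴰ
sumFinᴰ (suc n) F = F zero +ᴰ sumFinᴰ n (λ j → F (suc j))

sumUpToᴰ : ℕ → (ℕ → Dual) → Dual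
sumUpToᴰ zero    F = F 0
sumUpToᴰ (suc n) F = sumUpToᴰ n F +ᴰ F (suc n)

signᴰ : ℕ → Dual → Dual
signᴰ zero          x = x
signᴰ (suc zero)    x = -ᴰ x
signᴰ (suc (suc k)) x = signᴰ k x

minor : ∀ {n} → (Fin (suc n) → Fin (suc n) → Dual) → Fin (suc n) → Fin n → Fin n → Dual
minor M j r s = M (suc r) (punchIn j s)

detᴰ : (n : ℕ) → (Fin n → Fin n → Dual) → Dual
detᴰ zero    M = 1ᴰ
detᴰ (suc n) M = sumFinᴰ (suc n) (λ j → signᴰ (toℕ j) (M zero j *ᴰ detᴰ n (minor M j)))

sumFinᴰ-cong : ∀ n {F G} → (∀ j → F j ≡ G j) → sumFinᴰ n F ≡ sumFinᴰ n G
sumFinᴰ-cong zero    F≡G = refl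
sumFinᴰ-cong (suc n) F≡G = cong₂ _+ᴰ_ (F≡G zero) (sumFinᴰ-cong n (λ j → F≡G (suc j)))

sumFinᴰ-zero : ∀ n {F} → (∀ j → F j ≡ 0ᴰ) → sumFinᴰ n F ≡ 0ᴰ
sumFinᴰ-zero zero    F≡0 = refl
sumFinᴰ-zero (suc n) F≡0 =
  trans (cong₂ _+ᴰ_ (F≡0 zero) (sumFinᴰ-zero n (λ j → F≡0 (suc j)))) (+ᴰ-identityˡ 0ᴰ)

sumFinᴰ-single : ∀ n {F} k → (∀ j → j ≢ k → F j ≡ 0ᴰ) → sumFinᴰ n F ≡ F k
sumFinᴰ-single (suc n) {F} zero F≡0 =
  trans (cong (F zero +ᴰ_) (sumFinᴰ-zero n (λ j → F≡0 (suc j) λ ()))) (+ᴰ-identityʳ (F zero))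
sumFinᴰ-single (suc n) {F} (suc k) F≡0 =
  trans (cong₂ _+ᴰ_ (F≡0 zero λ ())
                    (sumFinᴰ-single n k λ j j≢k → F≡0 (suc j) (j≢k ∘ Finₚ.suc-injective)))
        (+ᴰ-identityˡ (F (suc k)))

signᴰ-zero : ∀ k → signᴰ k 0ᴰ ≡ 0ᴰ
signᴰ-zero zero          = refl
signᴰ-zero (suc zero)    = refl
signᴰ-zero (suc (suc k)) = signᴰ-zero k

signᴰ-distrib-+ᴰ : ∀ k x y → signᴰ k (x +ᴰ y) ≡ signᴰ k x +ᴰ signᴰ k y
signᴰ-distrib-+ᴰ zero          x y = refl
signᴰ-distrib-+ᴰ (suc zero)    x y = -ᴰ-distrib-+ᴰ x y
signᴰ-distrib-+ᴰ (suc (suc k)) x y = signᴰ-distrib-+ᴰ k x y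

signᴰ-involutive : ∀ k x → signᴰ k (signᴰ k x) ≡ x
signᴰ-involutive zero          x = refl
signᴰ-involutive (suc zero)    x = -ᴰ-involutive x
signᴰ-involutive (suc (suc k)) x = signᴰ-involutive k x

signᴰ-suc-signᴰ : ∀ k x → signᴰ (suc k) (signᴰ k x) ≡ -ᴰ x
signᴰ-suc-signᴰ zero          x = refl
signᴰ-suc-signᴰ (suc zero)    x = refl
signᴰ-suc-signᴰ (suc (suc k)) x = signᴰ-suc-signᴰ k x

detᴰ-cong : ∀ n {A B} → (∀ r c → A r c ≡ B r c) → detᴰ n A ≡ detᴰ n B
detᴰ-cong zero    A≡B = refl
detᴰ-cong (suc n) A≡B = sumFinᴰ-cong (suc n) λ j →
  cong (signᴰ (toℕ j))
       (cong₂ _*ᴰ_ (A≡B zero j) (detᴰ-cong n λ r s → A≡B (suc r) (punchIn j s)))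

detᴰ-expand-single : ∀ n M k → (∀ j → j ≢ k → M zero j ≡ 0ᴰ) →
  detᴰ (suc n) M ≡ signᴰ (toℕ k) (M zero k *ᴰ detᴰ n (minor M k))
detᴰ-expand-single n M k row≡0 = sumFinᴰ-single (suc n) k λ j j≢k → begin
  signᴰ (toℕ j) (M zero j *ᴰ detᴰ n (minor M j))
    ≡⟨ cong (λ x → signᴰ (toℕ j) (x *ᴰ detᴰ n (minor M j))) (row≡0 j j≢k) ⟩
  signᴰ (toℕ j) (0ᴰ *ᴰ detᴰ n (minor M j))
    ≡⟨ cong (signᴰ (toℕ j)) (*ᴰ-zeroˡ _) ⟩
  signᴰ (toℕ j) 0ᴰ
    ≡⟨ signᴰ-zero (toℕ j) ⟩
  0ᴰ ∎
  where open ≡-Reasoning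

δᴰ : ℕ → ℕ → Dual
δᴰ a b = if does (a ℕ.≟ b) then 1ᴰ else 0ᴰ

detᴰ-identity : ∀ n A → (∀ r c → A r c ≡ δᴰ (toℕ c) (toℕ r)) → detᴰ n A ≡ 1ᴰ
detᴰ-identity zero    A A≡δ = refl
detᴰ-identity (suc n) A A≡δ = begin
  detᴰ (suc n) A                          ≡⟨ detᴰ-expand-single n A zero offDiagonal ⟩
  A zero zero *ᴰ detᴰ n (minor A zero)    ≡⟨ cong₂ _*ᴰ_ (A≡δ zero zero)
                                                  (detᴰ-identity n _ λ r s → A≡δ (suc r) (suc s)) ⟩
  1ᴰ *ᴰ 1ᴰ                                ≡⟨⟩
  1ᴰ                                      ∎
  where
  open ≡-Reasoning
  offDiagonal : ∀ j → j ≢ zero → A zero j ≡ 0ᴰ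
  offDiagonal zero    j≢0 = ⊥-elim (j≢0 refl)
  offDiagonal (suc j) _   = A≡δ zero (suc j)

toℕ-punchIn-fromℕ : ∀ m (s : Fin m) → toℕ (punchIn (fromℕ m) s) ≡ toℕ s
toℕ-punchIn-fromℕ (suc m) zero    = refl
toℕ-punchIn-fromℕ (suc m) (suc s) = cong suc (toℕ-punchIn-fromℕ m s)

detᴰ-cyclic : ∀ m A x →
  (∀ c → c ≢ fromℕ m → A zero c ≡ 0ᴰ) → A zero (fromℕ m) ≡ x →
  (∀ r c → A (suc r) c ≡ δᴰ (toℕ c) (toℕ r)) →
  detᴰ (suc m) A ≡ signᴰ m x
detᴰ-cyclic m A x row≡0 corner rows = begin
  detᴰ (suc m) A
    ≡⟨ detᴰ-expand-single m A (fromℕ m) row≡0 ⟩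
  signᴰ (toℕ (fromℕ m)) (A zero (fromℕ m) *ᴰ detᴰ m (minor A (fromℕ m)))
    ≡⟨ cong₂ signᴰ (Finₚ.toℕ-fromℕ m) (cong₂ _*ᴰ_ corner (detᴰ-identity m _ minor≡δ)) ⟩
  signᴰ m (x *ᴰ 1ᴰ)
    ≡⟨ cong (signᴰ m) (*ᴰ-identityʳ x) ⟩
  signᴰ m x ∎
  where
  open ≡-Reasoning
  minor≡δ : ∀ r s → minor A (fromℕ m) r s ≡ δᴰ (toℕ s) (toℕ r)
  minor≡δ r s = trans (rows r _) (cong (λ t → δᴰ t (toℕ r)) (toℕ-punchIn-fromℕ m s))

insert-↭ : ∀ x ys → insert x ys ↭ x ∷ ys
insert-↭ x []       = ↭-refl
insert-↭ x (y ∷ ys) with does (x ℕ.≤? y)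
... | true  = ↭-refl
... | false = ↭-trans (prep y (insert-↭ x ys)) (swap y x ↭-refl)

monMul-↭ : ∀ ν μ → monMul ν μ ↭ ν ++ μ
monMul-↭ []      μ = ↭-refl
monMul-↭ (a ∷ ν) μ = ↭-trans (insert-↭ a (monMul ν μ)) (prep a (monMul-↭ ν μ))

length-monMul : ∀ ν μ → length (monMul ν μ) ≡ length ν ℕ.+ length μ
length-monMul ν μ = trans (↭-length (monMul-↭ ν μ)) (Listₚ.length-++ ν)

module Evaluation (v : ℕ) where

  w : ℕ
  w = suc v

  evMon : Monomial → Dual
  evMon []          = 1ᴰ
  evMon (a ∷ [])    = if does (a ℕ.≟ w) then ε else 0ᴰ
  evMon (_ ∷ _ ∷ _) = 0ᴰ

  evTerm : ℤ × Monomial → Dual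
  evTerm (k , ν) = k ·ᴰ evMon ν

  ev : Poly → Dual
  ev []      = 0ᴰ
  ev (t ∷ f) = evTerm t +ᴰ ev f

  evMon-∷ : ∀ a ν → evMon (a ∷ ν) ≡ 0ᴰ ⊎ evMon (a ∷ ν) ≡ ε
  evMon-∷ a (_ ∷ _) = inj₁ refl
  evMon-∷ a []      with does (a ℕ.≟ w)
  ... | true  = inj₂ refl
  ... | false = inj₁ refl

  evMon-∷-*ᴰ-∷ : ∀ a ν b μ → evMon (a ∷ ν) *ᴰ evMon (b ∷ μ) ≡ 0ᴰ
  evMon-∷-*ᴰ-∷ a ν b μ with evMon-∷ a ν | evMon-∷ b μ
  ... | inj₁ x≡0 | _        = trans (cong (_*ᴰ _) x≡0) (*ᴰ-zeroˡ _)
  ... | inj₂ x≡ε | inj₁ y≡0 = trans (cong (_ *ᴰ_) y≡0) (*ᴰ-zeroʳ _)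
  ... | inj₂ x≡ε | inj₂ y≡ε = cong₂ _*ᴰ_ x≡ε y≡ε

  evMon-long : ∀ ν → 2 ℕ.≤ length ν → evMon ν ≡ 0ᴰ
  evMon-long (_ ∷ [])    (s≤s ())
  evMon-long (_ ∷ _ ∷ _) _ = refl

  evMon-monMul-long : ∀ ν μ → 2 ℕ.≤ length ν ℕ.+ length μ → evMon (monMul ν μ) ≡ 0ᴰ
  evMon-monMul-long ν μ 2≤ =
    evMon-long (monMul ν μ) (subst (2 ℕ.≤_) (sym (length-monMul ν μ)) 2≤)

  evMon-monMul : ∀ ν μ → evMon (monMul ν μ) ≡ evMon ν *ᴰ evMon μ
  evMon-monMul []          μ       = sym (*ᴰ-identityˡ (evMon μ))
  evMon-monMul (a ∷ [])    []      = sym (*ᴰ-identityʳ (evMon (a ∷ [])))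
  evMon-monMul (a ∷ [])    (b ∷ μ) =
    trans (evMon-monMul-long (a ∷ []) (b ∷ μ) (s≤s (s≤s z≤n))) (sym (evMon-∷-*ᴰ-∷ a [] b μ))
  evMon-monMul (a ∷ b ∷ ν) μ       =
    trans (evMon-monMul-long (a ∷ b ∷ ν) μ (s≤s (s≤s z≤n))) (sym (*ᴰ-zeroˡ (evMon μ)))

  ev-++ : ∀ f g → ev (f ++ g) ≡ ev f +ᴰ ev g
  ev-++ []      g = sym (+ᴰ-identityˡ (ev g))
  ev-++ (t ∷ f) g = trans (cong (evTerm t +ᴰ_) (ev-++ f g)) (sym (+ᴰ-assoc (evTerm t) (ev f) (ev g)))

  ev-neg : ∀ f → ev (-P f) ≡ -ᴰ ev f
  ev-neg []            = refl
  ev-neg ((k , ν) ∷ f) =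
    trans (cong₂ _+ᴰ_ (-ᴰ-·ᴰ k (evMon ν)) (ev-neg f))
          (sym (-ᴰ-distrib-+ᴰ (k ·ᴰ evMon ν) (ev f)))

  ev-* : ∀ f g → ev (f *P g) ≡ ev f *ᴰ ev g
  ev-* []      g = sym (*ᴰ-zeroˡ (ev g))
  ev-* (s ∷ f) g = begin
    ev (map (s ·_) g ++ f *P g)      ≡⟨ ev-++ (map (s ·_) g) (f *P g) ⟩
    ev (map (s ·_) g) +ᴰ ev (f *P g) ≡⟨ cong₂ _+ᴰ_ (ev-scale g) (ev-* f g) ⟩
    evTerm s *ᴰ ev g +ᴰ ev f *ᴰ ev g ≡⟨ *ᴰ-distribʳ-+ᴰ (ev g) (evTerm s) (ev f) ⟨
    (evTerm s +ᴰ ev f) *ᴰ ev g       ∎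
    where
    open ≡-Reasoning
    _·_ : ℤ × Monomial → ℤ × Monomial → ℤ × Monomial
    (k , ν) · (l , μ) = (k ℤ.* l , monMul ν μ)
    ev-scale : ∀ g → ev (map (s ·_) g) ≡ evTerm s *ᴰ ev g
    ev-scale []            = sym (*ᴰ-zeroʳ (evTerm s))
    ev-scale ((l , μ) ∷ g) =
      trans (cong₂ _+ᴰ_ (trans (cong (_ ·ᴰ_) (evMon-monMul (proj₂ s) μ)) (*-·ᴰ-*ᴰ (proj₁ s) l _ _))
                        (ev-scale g))
            (sym (*ᴰ-distribˡ-+ᴰ (evTerm s) (evTerm (l , μ)) (ev g)))

  ev-signP : ∀ k f → ev (signP k f) ≡ signᴰ k (ev f)
  ev-signP zero          f = refl
  ev-signP (suc zero)    f = ev-neg f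
  ev-signP (suc (suc k)) f = ev-signP k f

  ev-sumFin : ∀ n F → ev (sumFin n F) ≡ sumFinᴰ n (λ j → ev (F j))
  ev-sumFin zero    F = refl
  ev-sumFin (suc n) F =
    trans (ev-++ (F zero) _) (cong (ev (F zero) +ᴰ_) (ev-sumFin n (λ j → F (suc j))))

  ev-sumUpTo : ∀ n F → ev (sumUpTo n F) ≡ sumUpToᴰ n (λ c → ev (F c))
  ev-sumUpTo zero    F = refl
  ev-sumUpTo (suc n) F =
    trans (ev-++ (sumUpTo n F) (F (suc n))) (cong (_+ᴰ ev (F (suc n))) (ev-sumUpTo n F))

  ev-det : ∀ n M → ev (det n M) ≡ detᴰ n (λ r c → ev (M r c))
  ev-det zero    M = refl
  ev-det (suc n) M =
    trans (ev-sumFin (suc n) λ j → signP (toℕ j) (M zero j *P det n (Mʲ j)))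
          (sumFinᴰ-cong (suc n) λ j → begin
      ev (signP (toℕ j) (M zero j *P det n (Mʲ j)))
        ≡⟨ ev-signP (toℕ j) _ ⟩
      signᴰ (toℕ j) (ev (M zero j *P det n (Mʲ j)))
        ≡⟨ cong (signᴰ (toℕ j)) (ev-* (M zero j) _) ⟩
      signᴰ (toℕ j) (ev (M zero j) *ᴰ ev (det n (Mʲ j)))
        ≡⟨ cong (λ x → signᴰ (toℕ j) (ev (M zero j) *ᴰ x)) (ev-det n (Mʲ j)) ⟩
      signᴰ (toℕ j) (ev (M zero j) *ᴰ detᴰ n (λ r s → ev (Mʲ j r s))) ∎)
    where
    open ≡-Reasoning
    Mʲ : Fin (suc n) → Fin n → Fin n → Poly
    Mʲ j r s = M (suc r) (punchIn j s)

  evMon-w : evMon (w ∷ []) ≡ ε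
  evMon-w = cong (if_then ε else 0ᴰ) (dec-true (w ℕ.≟ w) refl)

  evMon-≢ : ∀ {a} → a ≢ w → evMon (a ∷ []) ≡ 0ᴰ
  evMon-≢ {a} a≢w = cong (if_then ε else 0ᴰ) (dec-false (a ℕ.≟ w) a≢w)

  ε-part-evMon : ∀ ν → ν ≢ w ∷ [] → ε-part (evMon ν) ≡ 0ℤ
  ε-part-evMon []          _   = refl
  ε-part-evMon (a ∷ [])    ν≢w = cong ε-part (evMon-≢ (ν≢w ∘ cong (_∷ [])))
  ε-part-evMon (a ∷ b ∷ ν) _   = refl

  ε-part-ev : ∀ f → ε-part (ev f) ≡ coeff f (w ∷ [])
  ε-part-ev []            = refl
  ε-part-ev ((k , ν) ∷ f) = begin
    ε-part (k ·ᴰ evMon ν +ᴰ ev f)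
      ≡⟨ ε-part-+ᴰ (k ·ᴰ evMon ν) (ev f) ⟩
    ε-part (k ·ᴰ evMon ν) ℤ.+ ε-part (ev f)
      ≡⟨ cong₂ ℤ._+_ (ε-part-·ᴰ k (evMon ν)) (ε-part-ev f) ⟩
    k ℤ.* ε-part (evMon ν) ℤ.+ coeff f (w ∷ [])
      ≡⟨ first-term ⟩
    coeff ((k , ν) ∷ f) (w ∷ []) ∎
    where
    open ≡-Reasoning
    first-term : k ℤ.* ε-part (evMon ν) ℤ.+ coeff f (w ∷ []) ≡ coeff ((k , ν) ∷ f) (w ∷ [])
    first-term with Listₚ.≡-dec ℕ._≟_ ν (w ∷ [])
    ... | yes ν≡w = cong (ℤ._+ coeff f (w ∷ [])) (begin
      k ℤ.* ε-part (evMon ν)        ≡⟨ cong (λ μ → k ℤ.* ε-part (evMon μ)) ν≡w ⟩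
      k ℤ.* ε-part (evMon (w ∷ [])) ≡⟨ cong (λ x → k ℤ.* ε-part x) evMon-w ⟩
      k ℤ.* 1ℤ                      ≡⟨ ℤₚ.*-identityʳ k ⟩
      k                             ∎)
    ... | no  ν≢w = trans (cong (ℤ._+ coeff f (w ∷ []))
      (trans (cong (k ℤ.*_) (ε-part-evMon ν ν≢w)) (ℤₚ.*-zeroʳ k))) (ℤₚ.+-identityˡ _)

  ev-ρ-suc : ∀ c → ev (ρ (suc c)) ≡ evMon (suc c ∷ [])
  ev-ρ-suc c = trans (+ᴰ-identityʳ _) (·ᴰ-identity _)

  hᴰ : ℕ → ℕ → Dual
  hᴰ b zero    = 1ᴰ
  hᴰ b (suc n) = if does (suc n ℕ.≟ w) then dual 0ℤ (+ b) else 0ᴰ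

  hᴰ-w : ∀ b → hᴰ b w ≡ dual 0ℤ (+ b)
  hᴰ-w b = cong (if_then dual 0ℤ (+ b) else 0ᴰ) (dec-true (w ℕ.≟ w) refl)

  hᴰ-≢ : ∀ {n} b → suc n ≢ w → hᴰ b (suc n) ≡ 0ᴰ
  hᴰ-≢ {n} b n≢w = cong (if_then dual 0ℤ (+ b) else 0ᴰ) (dec-false (suc n ℕ.≟ w) n≢w)

  hᴰ-irrelevant : ∀ {n} b b′ → n ≢ w → hᴰ b n ≡ hᴰ b′ n
  hᴰ-irrelevant {zero}  b b′ _   = refl
  hᴰ-irrelevant {suc n} b b′ n≢w = trans (hᴰ-≢ b n≢w) (sym (hᴰ-≢ b′ n≢w))

  ε-*ᴰ-hᴰ-suc : ∀ b n → ε *ᴰ hᴰ b (suc n) ≡ 0ᴰ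
  ε-*ᴰ-hᴰ-suc b n with does (suc n ℕ.≟ w)
  ... | true  = pure-ε-nilpotent 1ℤ (+ b)
  ... | false = *ᴰ-zeroʳ ε

  Sparse : (ℕ → Dual) → Set
  Sparse G = ∀ c → c ≢ 0 → c ≢ w → G c ≡ 0ᴰ

  sumUpToᴰ-below : ∀ n {G} → Sparse G → n < w → sumUpToᴰ n G ≡ G 0
  sumUpToᴰ-below zero    _        _   = refl
  sumUpToᴰ-below (suc n) {G} sparse n<w = begin
    sumUpToᴰ n G +ᴰ G (suc n) ≡⟨ cong₂ _+ᴰ_ (sumUpToᴰ-below n sparse (ℕₚ.<⇒≤ n<w))
                                           (sparse (suc n) (λ ()) (ℕₚ.<⇒≢ n<w)) ⟩
    G 0 +ᴰ 0ᴰ                ≡⟨ +ᴰ-identityʳ (G 0) ⟩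
    G 0                      ∎
    where open ≡-Reasoning

  sumUpToᴰ-above : ∀ n {G} → Sparse G → w ≤ n → sumUpToᴰ n G ≡ G 0 +ᴰ G w
  sumUpToᴰ-above (suc n) {G} sparse w≤1+n with w ℕ.≤? n
  ... | yes w≤n = begin
    sumUpToᴰ n G +ᴰ G (suc n) ≡⟨ cong₂ _+ᴰ_ (sumUpToᴰ-above n sparse w≤n)
                                           (sparse (suc n) (λ ()) (ℕₚ.>⇒≢ (s≤s w≤n))) ⟩
    G 0 +ᴰ G w +ᴰ 0ᴰ         ≡⟨ +ᴰ-identityʳ _ ⟩
    G 0 +ᴰ G w               ∎
    where open ≡-Reasoning
  ... | no  w≰n = cong₂ _+ᴰ_ (sumUpToᴰ-below n sparse (ℕₚ.≰⇒> w≰n))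
                             (cong G (ℕₚ.≤-antisym (ℕₚ.≰⇒> w≰n) w≤1+n))

  ev-hℕ : ∀ b n → ev (hℕ b n) ≡ hᴰ b n
  ev-hℕ zero    zero    = refl
  ev-hℕ zero    (suc n) = sym (if-eta (does (suc n ℕ.≟ w)))
  ev-hℕ (suc b) n = trans (ev-sumUpTo n _) convolution
    where
    G : ℕ → Dual
    G c = ev (ρ c *P hℕ b (n ∸ c))
    sparse : Sparse G
    sparse zero    c≢0 _   = ⊥-elim (c≢0 refl)
    sparse (suc c) _   c≢w = begin
      ev (ρ (suc c) *P hℕ b (n ∸ suc c))      ≡⟨ ev-* (ρ (suc c)) (hℕ b (n ∸ suc c)) ⟩
      ev (ρ (suc c)) *ᴰ ev (hℕ b (n ∸ suc c)) ≡⟨ cong (_*ᴰ ev (hℕ b (n ∸ suc c))) ρ↦0 ⟩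
      0ᴰ *ᴰ ev (hℕ b (n ∸ suc c))             ≡⟨ *ᴰ-zeroˡ _ ⟩
      0ᴰ                                       ∎
      where
      open ≡-Reasoning
      ρ↦0 : ev (ρ (suc c)) ≡ 0ᴰ
      ρ↦0 = trans (ev-ρ-suc c) (evMon-≢ c≢w)
    G-zero : G 0 ≡ hᴰ b n
    G-zero = trans (ev-* (ρ 0) (hℕ b n)) (trans (*ᴰ-identityˡ _) (ev-hℕ b n))
    G-w : G w ≡ ε *ᴰ hᴰ b (n ∸ w)
    G-w = trans (ev-* (ρ w) (hℕ b (n ∸ w)))
                (cong₂ _*ᴰ_ (trans (ev-ρ-suc v) evMon-w) (ev-hℕ b (n ∸ w)))
    convolution : sumUpToᴰ n G ≡ hᴰ (suc b) n
    convolution with ℕ.<-cmp n w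
    ... | tri< n<w n≢w _ = begin
      sumUpToᴰ n G  ≡⟨ sumUpToᴰ-below n sparse n<w ⟩
      G 0           ≡⟨ G-zero ⟩
      hᴰ b n        ≡⟨ hᴰ-irrelevant b (suc b) n≢w ⟩
      hᴰ (suc b) n  ∎
      where open ≡-Reasoning
    ... | tri≈ _ n≡w _ = begin
      sumUpToᴰ n G                ≡⟨ sumUpToᴰ-above n sparse (ℕₚ.≤-reflexive (sym n≡w)) ⟩
      G 0 +ᴰ G w                  ≡⟨ cong₂ _+ᴰ_ G-zero G-w ⟩
      hᴰ b n +ᴰ ε *ᴰ hᴰ b (n ∸ w) ≡⟨ cong (λ m → hᴰ b m +ᴰ ε *ᴰ hᴰ b (m ∸ w)) n≡w ⟩
      hᴰ b w +ᴰ ε *ᴰ hᴰ b (w ∸ w) ≡⟨ cong (λ m → hᴰ b w +ᴰ ε *ᴰ hᴰ b m) (ℕₚ.n∸n≡0 w) ⟩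
      hᴰ b w +ᴰ ε                 ≡⟨ cong (_+ᴰ ε) (hᴰ-w b) ⟩
      dual 0ℤ (+ b ℤ.+ 1ℤ)        ≡⟨ cong (dual 0ℤ ∘ +_) (ℕₚ.+-comm b 1) ⟩
      dual 0ℤ (+ suc b)           ≡⟨ hᴰ-w (suc b) ⟨
      hᴰ (suc b) w                ≡⟨ cong (hᴰ (suc b)) n≡w ⟨
      hᴰ (suc b) n                ∎
      where open ≡-Reasoning
    ... | tri> _ n≢w w<n = begin
      sumUpToᴰ n G                ≡⟨ sumUpToᴰ-above n sparse (ℕₚ.<⇒≤ w<n) ⟩
      G 0 +ᴰ G w                  ≡⟨ cong₂ _+ᴰ_ G-zero (trans G-w (ε-*ᴰ-hᴰ-above w<n)) ⟩
      hᴰ b n +ᴰ 0ᴰ                ≡⟨ +ᴰ-identityʳ _ ⟩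
      hᴰ b n                      ≡⟨ hᴰ-irrelevant b (suc b) n≢w ⟩
      hᴰ (suc b) n                ∎
      where
      open ≡-Reasoning
      ε-*ᴰ-hᴰ-above : ∀ {m} → w < m → ε *ᴰ hᴰ b (m ∸ w) ≡ 0ᴰ
      ε-*ᴰ-hᴰ-above {suc m} (s≤s w≤m) =
        trans (cong (λ k → ε *ᴰ hᴰ b k) (ℕₚ.+-∸-assoc 1 w≤m)) (ε-*ᴰ-hᴰ-suc b (m ∸ w))

  hᴰ-below : ∀ b {t} → t < w → hᴰ b t ≡ δᴰ t 0
  hᴰ-below b {zero}  _   = refl
  hᴰ-below b {suc t} t<w = hᴰ-≢ b (ℕₚ.<⇒≢ t<w)

  ev-h-unshifted : ∀ b c → ev (h b (+ c ℤ.- + 0)) ≡ hᴰ b c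
  ev-h-unshifted b c = trans (cong (ev ∘ h b) (ℤₚ.+-identityʳ (+ c))) (ev-hℕ b c)

  -- For 1 ≤ a the weight c - a stays below w, so only the constant term of h can survive.
  ev-h-shifted : ∀ b {a c} → 1 ℕ.≤ a → c ℕ.≤ w → ev (h b (+ c ℤ.- + a)) ≡ δᴰ c a
  ev-h-shifted b {a} {c} 1≤a c≤w with ℕ.<-cmp c a
  ... | tri< c<a c≢a _ = begin
    ev (h b (+ c ℤ.- + a))      ≡⟨ cong (ev ∘ h b) (trans (ℤₚ.m-n≡m⊖n c a) (ℤₚ.⊖-< c<a)) ⟩
    ev (h b (ℤ.- + (a ∸ c)))    ≡⟨ ev-h-negative (ℕₚ.m<n⇒0<n∸m c<a) ⟩
    0ᴰ                           ≡⟨ cong (if_then 1ᴰ else 0ᴰ) (dec-false (c ℕ.≟ a) c≢a) ⟨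
    δᴰ c a                       ∎
    where
    open ≡-Reasoning
    ev-h-negative : ∀ {k} → 0 < k → ev (h b (ℤ.- + k)) ≡ 0ᴰ
    ev-h-negative {suc k} _ = refl
  ... | tri≈ _ refl _ = begin
    ev (h b (+ c ℤ.- + c))      ≡⟨ cong (ev ∘ h b) (ℤₚ.+-inverseʳ (+ c)) ⟩
    ev (h b 0ℤ)                  ≡⟨ ev-hℕ b 0 ⟩
    1ᴰ                           ≡⟨ cong (if_then 1ᴰ else 0ᴰ) (dec-true (c ℕ.≟ c) refl) ⟨
    δᴰ c c                       ∎
    where open ≡-Reasoning
  ... | tri> _ c≢a a<c = begin
    ev (h b (+ c ℤ.- + a))      ≡⟨ cong (ev ∘ h b) (trans (ℤₚ.m-n≡m⊖n c a) (ℤₚ.⊖-≥ (ℕₚ.<⇒≤ a<c))) ⟩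
    ev (hℕ b (c ∸ a))            ≡⟨ ev-hℕ b (c ∸ a) ⟩
    hᴰ b (c ∸ a)                 ≡⟨ hᴰ-positive-below (ℕₚ.m>n⇒m∸n≢0 a<c) c-a<w ⟩
    0ᴰ                           ≡⟨ cong (if_then 1ᴰ else 0ᴰ) (dec-false (c ℕ.≟ a) c≢a) ⟨
    δᴰ c a                       ∎
    where
    open ≡-Reasoning
    c-a<w : c ∸ a < w
    c-a<w = ℕₚ.<-≤-trans (ℕₚ.∸-monoʳ-< 1≤a (ℕₚ.<⇒≤ a<c)) c≤w
    hᴰ-positive-below : ∀ {k} → k ≢ 0 → k < w → hᴰ b k ≡ 0ᴰ
    hᴰ-positive-below {zero}  k≢0 _   = ⊥-elim (k≢0 refl)
    hᴰ-positive-below {suc k} _   k<w = hᴰ-≢ b (ℕₚ.<⇒≢ k<w)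

Weighted : ℤ → Monomial → Set
Weighted d ν = All (1 ℕ.≤_) ν × + sum ν ≡ d

Homogeneous : ℤ → Poly → Set
Homogeneous d = All (Weighted d ∘ proj₂)

Weighted-monMul : ∀ {d e} ν μ → Weighted d ν → Weighted e μ → Weighted (d ℤ.+ e) (monMul ν μ)
Weighted-monMul ν μ (pos-ν , Σν≡d) (pos-μ , Σμ≡e) =
    All-resp-↭ (↭-sym (monMul-↭ ν μ)) (Allₚ.++⁺ pos-ν pos-μ)
  , trans (cong +_ (trans (sum-↭ (monMul-↭ ν μ)) (sum-++ ν μ))) (cong₂ ℤ._+_ Σν≡d Σμ≡e)

Homogeneous-++ : ∀ {d} f g → Homogeneous d f → Homogeneous d g → Homogeneous d (f ++ g)
Homogeneous-++ f g = Allₚ.++⁺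

Homogeneous-signP : ∀ {d} k f → Homogeneous d f → Homogeneous d (signP k f)
Homogeneous-signP zero          f hf = hf
Homogeneous-signP (suc zero)    f hf = Allₚ.map⁺ (All.map id hf)
Homogeneous-signP (suc (suc k)) f hf = Homogeneous-signP k f hf

Homogeneous-*P : ∀ {d e} f g → Homogeneous d f → Homogeneous e g → Homogeneous (d ℤ.+ e) (f *P g)
Homogeneous-*P []      g All.[]      hg = All.[]
Homogeneous-*P (s ∷ f) g (ws All.∷ hf) hg =
  Homogeneous-++ _ (f *P g) (Allₚ.map⁺ (All.map (Weighted-monMul (proj₂ s) _ ws) hg))
                            (Homogeneous-*P f g hf hg)

Homogeneous-sumFin : ∀ {d} n F → (∀ j → Homogeneous d (F j)) → Homogeneous d (sumFin n F)
Homogeneous-sumFin zero    F hF = All.[]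
Homogeneous-sumFin (suc n) F hF =
  Homogeneous-++ (F zero) _ (hF zero) (Homogeneous-sumFin n _ (λ j → hF (suc j)))

Homogeneous-sumUpTo : ∀ {d} n F →
  (∀ c → c ℕ.≤ n → Homogeneous d (F c)) → Homogeneous d (sumUpTo n F)
Homogeneous-sumUpTo zero    F hF = hF 0 z≤n
Homogeneous-sumUpTo (suc n) F hF =
  Homogeneous-++ (sumUpTo n F) (F (suc n))
    (Homogeneous-sumUpTo n F (λ c c≤n → hF c (ℕₚ.m≤n⇒m≤1+n c≤n))) (hF (suc n) ℕₚ.≤-refl)

Homogeneous-ρ : ∀ c → Homogeneous (+ c) (ρ c)
Homogeneous-ρ zero    = (All.[] , refl) All.∷ All.[]
Homogeneous-ρ (suc c) = ((s≤s z≤n All.∷ All.[]) , cong +_ (ℕₚ.+-identityʳ (suc c))) All.∷ All.[]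

Homogeneous-hℕ : ∀ b n → Homogeneous (+ n) (hℕ b n)
Homogeneous-hℕ zero    zero    = (All.[] , refl) All.∷ All.[]
Homogeneous-hℕ zero    (suc n) = All.[]
Homogeneous-hℕ (suc b) n = Homogeneous-sumUpTo n _ λ c c≤n →
  subst (λ d → Homogeneous d (ρ c *P hℕ b (n ∸ c))) (cong +_ (ℕₚ.m+[n∸m]≡n c≤n))
    (Homogeneous-*P (ρ c) (hℕ b (n ∸ c)) (Homogeneous-ρ c) (Homogeneous-hℕ b (n ∸ c)))

Homogeneous-h : ∀ b d → Homogeneous d (h b d)
Homogeneous-h b (+ n)    = Homogeneous-hℕ b n
Homogeneous-h b -[1+ n ] = All.[]

sumℤ-punchIn : ∀ n (F : Fin (suc n) → ℤ) j →
  sumℤ (suc n) F ≡ F j ℤ.+ sumℤ n (λ s → F (punchIn j s))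
sumℤ-punchIn n       F zero    = refl
sumℤ-punchIn (suc n) F (suc j) =
  trans (cong (λ x → F zero ℤ.+ x) (sumℤ-punchIn n (λ s → F (suc s)) j))
        (left-comm (F zero) (F (suc j)) _)
  where
  left-comm : ∀ a b c → a ℤ.+ (b ℤ.+ c) ≡ b ℤ.+ (a ℤ.+ c)
  left-comm = solve-∀

Homogeneous-det : ∀ n M (β γ : Fin n → ℤ) → (∀ r c → Homogeneous (γ c ℤ.- β r) (M r c)) →
  Homogeneous (sumℤ n γ ℤ.- sumℤ n β) (det n M)
Homogeneous-det zero    M β γ hM = (All.[] , refl) All.∷ All.[]
Homogeneous-det (suc n) M β γ hM = Homogeneous-sumFin (suc n) _ λ j → Homogeneous-signP (toℕ j) _
  (subst (λ d → Homogeneous d (M zero j *P det n (Mʲ j))) (weight j)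
    (Homogeneous-*P (M zero j) _ (hM zero j)
      (Homogeneous-det n (Mʲ j) (β ∘ suc) (γ ∘ punchIn j) (λ r s → hM (suc r) (punchIn j s)))))
  where
  Mʲ : Fin (suc n) → Fin n → Fin n → Poly
  Mʲ j r s = M (suc r) (punchIn j s)
  rearrange : ∀ a b c d → (a ℤ.- b) ℤ.+ (c ℤ.- d) ≡ (a ℤ.+ c) ℤ.- (b ℤ.+ d)
  rearrange = solve-∀
  weight : ∀ j → (γ j ℤ.- β zero) ℤ.+ (sumℤ n (γ ∘ punchIn j) ℤ.- sumℤ n (β ∘ suc))
                ≡ sumℤ (suc n) γ ℤ.- sumℤ (suc n) β
  weight j = trans (rearrange (γ j) (β zero) _ _)
                   (cong (ℤ._- sumℤ (suc n) β) (sym (sumℤ-punchIn n γ j)))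

i+j-j≡i : ∀ i j → i ℤ.+ j ℤ.- j ≡ i
i+j-j≡i = solve-∀

choose2-suc : ∀ m → choose2 (suc m) ≡ m ℕ.+ choose2 m
choose2-suc zero    = refl
choose2-suc (suc k) = begin
  (suc (suc k) ℕ.* suc k) / 2            ≡⟨ cong (_/ 2) (expand k) ⟩
  (suc k ℕ.* k ℕ.+ suc k ℕ.* 2) / 2      ≡⟨ +-distrib-/-∣ʳ (suc k ℕ.* k) (divides-refl (suc k)) ⟩
  choose2 (suc k) ℕ.+ (suc k ℕ.* 2) / 2  ≡⟨ cong (choose2 (suc k) ℕ.+_) (m*n/n≡m (suc k) 2) ⟩
  choose2 (suc k) ℕ.+ suc k              ≡⟨ ℕₚ.+-comm (choose2 (suc k)) (suc k) ⟩
  suc k ℕ.+ choose2 (suc k)              ∎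
  where
  open ≡-Reasoning
  expand : ∀ k → suc (suc k) ℕ.* suc k ≡ suc k ℕ.* k ℕ.+ suc k ℕ.* 2
  expand = ℕSolver.solve-∀

sumℤ-cong : ∀ n {F G} → (∀ j → F j ≡ G j) → sumℤ n F ≡ sumℤ n G
sumℤ-cong zero    F≡G = refl
sumℤ-cong (suc n) F≡G = cong₂ ℤ._+_ (F≡G zero) (sumℤ-cong n (λ j → F≡G (suc j)))

sumℤ-1+ : ∀ n F → sumℤ n (λ j → 1ℤ ℤ.+ F j) ≡ + n ℤ.+ sumℤ n F
sumℤ-1+ zero    F = refl
sumℤ-1+ (suc n) F = begin
  1ℤ ℤ.+ F zero ℤ.+ sumℤ n (λ j → 1ℤ ℤ.+ F (suc j)) ≡⟨ cong (λ s → 1ℤ ℤ.+ F zero ℤ.+ s) (sumℤ-1+ n _) ⟩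
  1ℤ ℤ.+ F zero ℤ.+ (+ n ℤ.+ sumℤ n (F ∘ suc))       ≡⟨ regroup 1ℤ (F zero) (+ n) _ ⟩
  1ℤ ℤ.+ + n ℤ.+ (F zero ℤ.+ sumℤ n (F ∘ suc))       ∎
  where
  open ≡-Reasoning
  regroup : ∀ a b c d → a ℤ.+ b ℤ.+ (c ℤ.+ d) ≡ a ℤ.+ c ℤ.+ (b ℤ.+ d)
  regroup = solve-∀

sumℤ-toℕ : ∀ m → sumℤ m (λ j → + toℕ j) ≡ + choose2 m
sumℤ-toℕ zero    = refl
sumℤ-toℕ (suc m) = begin
  + 0 ℤ.+ sumℤ m (λ j → 1ℤ ℤ.+ + toℕ j) ≡⟨ ℤₚ.+-identityˡ _ ⟩
  sumℤ m (λ j → 1ℤ ℤ.+ + toℕ j)         ≡⟨ sumℤ-1+ m (λ j → + toℕ j) ⟩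
  + m ℤ.+ sumℤ m (λ j → + toℕ j)        ≡⟨ cong (λ s → + m ℤ.+ s) (sumℤ-toℕ m) ⟩
  + (m ℕ.+ choose2 m)                    ≡⟨ cong +_ (choose2-suc m) ⟨
  + choose2 (suc m)                      ∎
  where open ≡-Reasoning

φ-homogeneous : ∀ m P → Homogeneous (weightD m P) (φ m P)
φ-homogeneous m P = Homogeneous-signP ℤ.∣ weightD m P ∣ _
  (subst (λ d → Homogeneous (d ℤ.- sumℤ m (λ i → ∣ P i ∣)) (det m M)) (sumℤ-toℕ m)
    (Homogeneous-det m M (λ i → ∣ P i ∣) (λ j → + toℕ j) λ i j → Homogeneous-h (∣ P i ∣y) _))
  where
  M : Fin m → Fin m → Poly
  M i j = h (∣ P i ∣y) (+ toℕ j ℤ.- ∣ P i ∣)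

weightD-staircase : ∀ n P → (∀ r → ∣ P r ∣ ≡ + (toℕ r ∸ 1)) → weightD (suc n) P ≡ + n
weightD-staircase n P P≡ = begin
  + choose2 (suc n) ℤ.- sumℤ (suc n) (λ r → ∣ P r ∣)
    ≡⟨ cong₂ ℤ._-_ (cong +_ (choose2-suc n)) (sumℤ-cong (suc n) P≡) ⟩
  + (n ℕ.+ choose2 n) ℤ.- (+ 0 ℤ.+ sumℤ n (λ j → + toℕ j))
    ≡⟨ cong (λ s → + (n ℕ.+ choose2 n) ℤ.- (+ 0 ℤ.+ s)) (sumℤ-toℕ n) ⟩
  + n ℤ.+ + choose2 n ℤ.- + choose2 n
    ≡⟨ i+j-j≡i (+ n) (+ choose2 n) ⟩
  + n ∎
  where open ≡-Reasoning

coeff-≢0⇒Weighted : ∀ {d} f ν → coeff f ν ≢ 0ℤ → Homogeneous d f → Weighted d ν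
coeff-≢0⇒Weighted []            ν coeff≢0 All.[] = ⊥-elim (coeff≢0 refl)
coeff-≢0⇒Weighted ((k , μ) ∷ f) ν coeff≢0 (wμ All.∷ hf) with Listₚ.≡-dec ℕ._≟_ μ ν
... | yes refl = wμ
... | no  _    = coeff-≢0⇒Weighted f ν coeff≢0 hf

Weighted⇒≤Lex : ∀ {n} ν → Weighted (+ suc n) ν → ν ≡ suc n ∷ [] ⊎ ν <Lex (suc n ∷ [])
Weighted⇒≤Lex []          (_ , ())
Weighted⇒≤Lex (a ∷ [])    (_ , Σ≡) =
  inj₁ (cong (_∷ []) (trans (sym (ℕₚ.+-identityʳ a)) (ℤₚ.+-injective Σ≡)))
Weighted⇒≤Lex (a ∷ b ∷ ν) (_ All.∷ 1≤b All.∷ _ , Σ≡) =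
  inj₂ (here (subst (a <_) (ℤₚ.+-injective Σ≡)
                     (ℕₚ.m<m+n a (ℕₚ.<-≤-trans 1≤b (ℕₚ.m≤m+n b (sum ν))))))

Homogeneous⇒≤Lex : ∀ {n f} ν → Homogeneous (+ suc n) f → coeff f ν ≢ 0ℤ →
  ν ≡ suc n ∷ [] ⊎ ν <Lex (suc n ∷ [])
Homogeneous⇒≤Lex {f = f} ν hf coeff≢0 = Weighted⇒≤Lex ν (coeff-≢0⇒Weighted f ν coeff≢0 hf)

module Staircase (n : ℕ) (b : Fin (suc (suc n)) → ℕ) where
  open Evaluation n

  E : Fin (suc (suc n)) → Fin (suc (suc n)) → Dual
  E r c = ev (h (b r) (+ toℕ c ℤ.- + (toℕ r ∸ 1)))

  b₀ b₁ : ℕ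
  b₀ = b zero
  b₁ = b (suc zero)

  E-lower : ∀ r c → E (suc (suc r)) c ≡ δᴰ (toℕ c) (suc (toℕ r))
  E-lower r c = ev-h-shifted (b (suc (suc r))) (s≤s z≤n) (ℕₚ.≤-pred (Finₚ.toℕ<n c))

  toℕ≡n⇒≡fromℕ : ∀ {j : Fin (suc n)} → toℕ j ≡ n → j ≡ fromℕ n
  toℕ≡n⇒≡fromℕ j≡n = Finₚ.toℕ-injective (trans j≡n (sym (Finₚ.toℕ-fromℕ n)))

  hᴰ-last : ∀ bb → hᴰ bb (suc (toℕ (fromℕ n))) ≡ dual 0ℤ (+ bb)
  hᴰ-last bb = trans (cong (hᴰ bb ∘ suc) (Finₚ.toℕ-fromℕ n)) (hᴰ-w bb)

  hᴰ-not-last : ∀ bb (j : Fin (suc n)) → j ≢ fromℕ n → hᴰ bb (suc (toℕ j)) ≡ 0ᴰ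
  hᴰ-not-last bb j j≢n = hᴰ-≢ bb (j≢n ∘ toℕ≡n⇒≡fromℕ ∘ ℕₚ.suc-injective)

  det-minor-first : detᴰ (suc n) (minor E zero) ≡ signᴰ n (dual 0ℤ (+ b₁))
  det-minor-first = detᴰ-cyclic n (minor E zero) (dual 0ℤ (+ b₁))
    (λ c c≢n → trans (ev-h-unshifted b₁ _) (hᴰ-not-last b₁ c c≢n))
    (trans (ev-h-unshifted b₁ _) (hᴰ-last b₁))
    (λ r c → E-lower r (suc c))

  det-minor-last : detᴰ (suc n) (minor E (suc (fromℕ n))) ≡ 1ᴰ
  det-minor-last = detᴰ-identity (suc n) _ λ r s →
    trans (minor-entry r s) (cong (λ t → δᴰ t (toℕ r)) (toℕ-punchIn-fromℕ (suc n) s))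
    where
    minor-entry : ∀ r s →
      minor E (suc (fromℕ n)) r s ≡ δᴰ (toℕ (punchIn (suc (fromℕ n)) s)) (toℕ r)
    minor-entry zero    s = trans (ev-h-unshifted b₁ _)
      (hᴰ-below b₁ (subst (_< w) (sym (toℕ-punchIn-fromℕ (suc n) s)) (Finₚ.toℕ<n s)))
    minor-entry (suc r) s = E-lower r (punchIn (suc (fromℕ n)) s)

  det-E : detᴰ (suc (suc n)) E ≡ signᴰ n (dual 0ℤ (+ b₁)) +ᴰ signᴰ (suc n) (dual 0ℤ (+ b₀))
  det-E = cong₂ _+ᴰ_ first-column last-column
    where
    F : Fin (suc n) → Dual
    F j = signᴰ (suc (toℕ j)) (E zero (suc j) *ᴰ detᴰ (suc n) (minor E (suc j)))
    first-column : E zero zero *ᴰ detᴰ (suc n) (minor E zero) ≡ signᴰ n (dual 0ℤ (+ b₁))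
    first-column = trans (cong₂ _*ᴰ_ (ev-h-unshifted b₀ 0) det-minor-first) (*ᴰ-identityˡ _)
    last-column : sumFinᴰ (suc n) F ≡ signᴰ (suc n) (dual 0ℤ (+ b₀))
    last-column = begin
      sumFinᴰ (suc n) F
        ≡⟨ sumFinᴰ-single (suc n) (fromℕ n) vanishes ⟩
      signᴰ (suc (toℕ (fromℕ n))) (E zero (suc (fromℕ n)) *ᴰ detᴰ (suc n) (minor E (suc (fromℕ n))))
        ≡⟨ cong₂ (signᴰ ∘ suc) (Finₚ.toℕ-fromℕ n)
                 (cong₂ _*ᴰ_ (trans (ev-h-unshifted b₀ _) (hᴰ-last b₀)) det-minor-last) ⟩
      signᴰ (suc n) (dual 0ℤ (+ b₀) *ᴰ 1ᴰ)
        ≡⟨ cong (signᴰ (suc n)) (*ᴰ-identityʳ _) ⟩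
      signᴰ (suc n) (dual 0ℤ (+ b₀)) ∎
      where
      open ≡-Reasoning
      vanishes : ∀ j → j ≢ fromℕ n → F j ≡ 0ᴰ
      vanishes j j≢n = begin
        F j ≡⟨ cong (λ x → signᴰ (suc (toℕ j)) (x *ᴰ detᴰ (suc n) (minor E (suc j))))
                    (trans (ev-h-unshifted b₀ _) (hᴰ-not-last b₀ j j≢n)) ⟩
        signᴰ (suc (toℕ j)) (0ᴰ *ᴰ detᴰ (suc n) (minor E (suc j)))
          ≡⟨ cong (signᴰ (suc (toℕ j))) (*ᴰ-zeroˡ _) ⟩
        signᴰ (suc (toℕ j)) 0ᴰ ≡⟨ signᴰ-zero (suc (toℕ j)) ⟩
        0ᴰ ∎

  signᴰ-det-E : signᴰ (suc n) (detᴰ (suc (suc n)) E) ≡ dual 0ℤ (+ b₀ ℤ.- + b₁)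
  signᴰ-det-E = begin
    signᴰ (suc n) (detᴰ (suc (suc n)) E)
      ≡⟨ cong (signᴰ (suc n)) det-E ⟩
    signᴰ (suc n) (signᴰ n (dual 0ℤ (+ b₁)) +ᴰ signᴰ (suc n) (dual 0ℤ (+ b₀)))
      ≡⟨ signᴰ-distrib-+ᴰ (suc n) _ _ ⟩
    signᴰ (suc n) (signᴰ n (dual 0ℤ (+ b₁))) +ᴰ signᴰ (suc n) (signᴰ (suc n) (dual 0ℤ (+ b₀)))
      ≡⟨ cong₂ _+ᴰ_ (signᴰ-suc-signᴰ n _) (signᴰ-involutive (suc n) _) ⟩
    dual 0ℤ (ℤ.- + b₁ ℤ.+ + b₀)
      ≡⟨ cong (dual 0ℤ) (ℤₚ.+-comm (ℤ.- + b₁) (+ b₀)) ⟩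
    dual 0ℤ (+ b₀ ℤ.- + b₁) ∎
    where open ≡-Reasoning

coeff-φ-staircase : ∀ n P → (∀ r → ∣ P r ∣ ≡ + (toℕ r ∸ 1)) →
  coeff (φ (suc (suc n)) P) (suc n ∷ []) ≡ + ∣ P zero ∣y ℤ.- + ∣ P (suc zero) ∣y
coeff-φ-staircase n P P≡ = begin
  coeff (φ (suc (suc n)) P) (w ∷ [])
    ≡⟨ ε-part-ev (φ (suc (suc n)) P) ⟨
  ε-part (ev (signP ℤ.∣ weightD (suc (suc n)) P ∣ (det _ M)))
    ≡⟨ cong (λ k → ε-part (ev (signP ℤ.∣ k ∣ (det _ M)))) (weightD-staircase (suc n) P P≡) ⟩
  ε-part (ev (signP w (det _ M)))                ≡⟨ cong ε-part (ev-signP w (det _ M)) ⟩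
  ε-part (signᴰ w (ev (det _ M)))                ≡⟨ cong (ε-part ∘ signᴰ w) (ev-det _ M) ⟩
  ε-part (signᴰ w (detᴰ _ (λ r c → ev (M r c)))) ≡⟨ cong (ε-part ∘ signᴰ w) (detᴰ-cong _ M≡E) ⟩
  ε-part (signᴰ w (detᴰ _ E))                    ≡⟨ cong ε-part signᴰ-det-E ⟩
  + b₀ ℤ.- + b₁                                  ∎
  where
  open ≡-Reasoning
  open Evaluation n
  open Staircase n (λ r → ∣ P r ∣y)
  M : Fin (suc (suc n)) → Fin (suc (suc n)) → Poly
  M r c = h ∣ P r ∣y (+ toℕ c ℤ.- ∣ P r ∣)
  M≡E : ∀ r c → ev (M r c) ≡ E r c
  M≡E r c = cong (λ d → ev (h ∣ P r ∣y (+ toℕ c ℤ.- d))) (P≡ r)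

Point-≡ : ∀ (p q : Point) → ∣ p ∣ ≡ ∣ q ∣ → ∣ p ∣y ≡ ∣ q ∣y → p ≡ q
Point-≡ (a , b) (a′ , .b) ∣p∣≡∣q∣ refl = cong (_, b) (begin
  a                   ≡⟨ i+j-j≡i a (+ b) ⟨
  a ℤ.+ + b ℤ.- + b   ≡⟨ cong (ℤ._- + b) ∣p∣≡∣q∣ ⟩
  a′ ℤ.+ + b ℤ.- + b  ≡⟨ i+j-j≡i a′ (+ b) ⟩
  a′                  ∎)
  where open ≡-Reasoning

lemma5p11 : (w : ℕ) → 2 ≤ w → (P : Fin (suc w) → Point) → InD' (suc w) P →
    (∀ i j → i ≢ j → P i ≢ P j) →
    (∀ i → toℕ i ≤ 1 → ∣ P i ∣ ≡ 0ℤ) →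
    (∀ i → 2 ≤ toℕ i → ∣ P i ∣ ≡ + (toℕ i ∸ 1)) →
    (i₁ i₂ : Fin (suc w)) → toℕ i₁ ≡ 0 → toℕ i₂ ≡ 1 →
    LeadingTerm (φ (suc w) P) (+ ∣ P i₁ ∣y - + ∣ P i₂ ∣y) (w ∷ [])
lemma5p11 (suc v) (s≤s _) P _ distinct ∣P∣≡0 ∣P∣≡i-1 zero (suc zero) refl refl =
    b₀-b₁≢0
  , coeff-φ-staircase v P staircase
  , λ ν → Homogeneous⇒≤Lex ν (subst (λ d → Homogeneous d (φ _ P))
                                     (weightD-staircase (suc v) P staircase) (φ-homogeneous _ P))
  where
  staircase : ∀ r → ∣ P r ∣ ≡ + (toℕ r ∸ 1)
  staircase r with toℕ r ℕ.≤? 1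
  ... | yes r≤1 = trans (∣P∣≡0 r r≤1) (cong +_ (sym (ℕₚ.m≤n⇒m∸n≡0 r≤1)))
  ... | no  r≰1 = ∣P∣≡i-1 r (ℕₚ.≰⇒> r≰1)
  b₀-b₁≢0 : + ∣ P zero ∣y - + ∣ P (suc zero) ∣y ≢ 0ℤ
  b₀-b₁≢0 b₀-b₁≡0 = distinct zero (suc zero) (λ ()) (Point-≡ (P zero) (P (suc zero))
    (trans (∣P∣≡0 zero z≤n) (sym (∣P∣≡0 (suc zero) (s≤s z≤n))))
    (ℤₚ.+-injective (ℤₚ.i-j≡0⇒i≡j _ _ b₀-b₁≡0)))
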